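{- Let $\alpha$ be a positive integer, $P$ an odd prime and $s$ a positive integer, and put $m_s:=4\alpha s^2+P$. Suppose $d$ is a positive divisor of $m_s$ with $d\equiv-1\pmod{4\alpha s}$. Set \[ r:=\frac{d+1}{4\alpha s}\in\mathbb{Z}_{\ge1},\qquad m:=\frac{m_s}{d},\qquad A(s,d):=\alpha s(mr-s). \] If $A(s,d)\in[L(P),U(P)]$, then with $d'=r$, $b'=s$, $c'=mr-s$ and $A=A(s,d)$ we have \[ (4\alpha d'b'-1)(4\alpha d'c'-1)=4\alpha Pd'^2+1, \] together with $A\in[L(P),U(P)]$ and $m=4A-P>0$.
   Context: $L(P)=\frac P4+\frac34$ and $U(P)=\frac{3P}4-\frac34$. -}

module Defs where

open import Data.Nat as ℕ using (ℕ)
open import Data.Integer as ℤ using (ℤ; +_)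
open import Data.Rational as ℚ using (ℚ; _/_)

L : ℕ → ℚ
L P = ((+ P) / 4) ℚ.+ ((+ 3) / 4)

U : ℕ → ℚ
U P = ((+ (3 ℕ.* P)) / 4) ℚ.- ((+ 3) / 4)

toℚ : ℤ → ℚ
toℚ z = z / 1

InLU : ℕ → ℤ → Set
InLU P z = (L P ℚ.≤ toℚ z) Data.Product.× (toℚ z ℚ.≤ U P)
  where import Data.Product

mₛ : ℕ → ℕ → ℕ → ℕ
mₛ α P s = 4 ℕ.* α ℕ.* (s ℕ.* s) ℕ.+ P

Aₛ : ℕ → ℕ → ℕ → ℕ → ℤ
Aₛ α s m r = (+ (α ℕ.* s)) ℤ.* ((+ (m ℕ.* r)) ℤ.- (+ s))

{-# OPTIONS --safe #-}
-- With d = 4αsr − 1, the hypothesis d m = 4αs² + P is a polynomial relation in α, s, r, m, P,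
-- and both the factorisation and m = 4A − P follow from it by ring arithmetic in ℤ.
-- Finally m > 0 because d m = mₛ > 0.
module Submission where

open import Defs
open import Data.Nat as ℕ using (ℕ; _%_; NonZero; >-nonZero; >-nonZero⁻¹)
open import Data.Nat.Divisibility using (_∣_)
open import Data.Nat.Primality using (Prime; prime⇒nonZero)
open import Data.Nat.Properties using (m*n≢0⇒n≢0; m≤n+m; ≤-trans)
open import Data.Integer as ℤ using (ℤ; +_; _+_; _-_; _*_)
open import Data.Integer.Properties using (pos-*; pos-+)
open import Data.Integer.Tactic.RingSolver using (solve-∀)
open import Data.Product using (_×_; _,_)
open import Relation.Binary.PropositionalEquality using (_≡_; refl; sym; trans; cong; cong₂; subst; module ≡-Reasoning)

open ≡-Reasoning

module _ (α s r m P : ℤ) (cofactor : (+ 4 * α * s * r - + 1) * m ≡ + 4 * α * (s * s) + P) where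

  -- The product is 4αr² · dm − d(d + 2), and (d + 1)² = (4αsr)² cancels the s-terms of 4αr² · dm.
  4αPr²+1-factorisation :
    (+ 4 * α * r * s - + 1) * (+ 4 * α * r * (m * r - s) - + 1) ≡ + 4 * α * P * (r * r) + + 1
  4αPr²+1-factorisation = begin
    (+ 4 * α * r * s - + 1) * (+ 4 * α * r * (m * r - s) - + 1)
      ≡⟨ expand α s r m ⟩
    + 4 * α * r * r * ((+ 4 * α * s * r - + 1) * m) - (+ 4 * α * s * r - + 1) * (+ 4 * α * s * r + + 1)
      ≡⟨ cong (λ dm → + 4 * α * r * r * dm - (+ 4 * α * s * r - + 1) * (+ 4 * α * s * r + + 1)) cofactor ⟩
    + 4 * α * r * r * (+ 4 * α * (s * s) + P) - (+ 4 * α * s * r - + 1) * (+ 4 * α * s * r + + 1)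
      ≡⟨ collect α s r P ⟩
    + 4 * α * P * (r * r) + + 1 ∎
    where
    expand : ∀ α s r m →
      (+ 4 * α * r * s - + 1) * (+ 4 * α * r * (m * r - s) - + 1)
        ≡ + 4 * α * r * r * ((+ 4 * α * s * r - + 1) * m) - (+ 4 * α * s * r - + 1) * (+ 4 * α * s * r + + 1)
    expand = solve-∀
    collect : ∀ α s r P →
      + 4 * α * r * r * (+ 4 * α * (s * s) + P) - (+ 4 * α * s * r - + 1) * (+ 4 * α * s * r + + 1)
        ≡ + 4 * α * P * (r * r) + + 1
    collect = solve-∀

  cofactor≡4A-P : m ≡ + 4 * (α * s * (m * r - s)) - P
  cofactor≡4A-P = begin
    m                                                           ≡⟨ expand α s r m P ⟩
    + 4 * (α * s * (m * r - s)) - P - ((+ 4 * α * s * r - + 1) * m - (+ 4 * α * (s * s) + P))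
      ≡⟨ cong (λ dm → + 4 * (α * s * (m * r - s)) - P - (dm - (+ 4 * α * (s * s) + P))) cofactor ⟩
    + 4 * (α * s * (m * r - s)) - P - (+ 4 * α * (s * s) + P - (+ 4 * α * (s * s) + P))
      ≡⟨ cancel (+ 4 * (α * s * (m * r - s)) - P) (+ 4 * α * (s * s) + P) ⟩
    + 4 * (α * s * (m * r - s)) - P ∎
    where
    expand : ∀ α s r m P →
      m ≡ + 4 * (α * s * (m * r - s)) - P - ((+ 4 * α * s * r - + 1) * m - (+ 4 * α * (s * s) + P))
    expand = solve-∀
    cancel : ∀ x y → x - (y - y) ≡ x
    cancel = solve-∀

pos-*³ : ∀ a b c → + (a ℕ.* b ℕ.* c) ≡ + a * + b * + c
pos-*³ a b c = trans (pos-* (a ℕ.* b) c) (cong (_* + c) (pos-* a b))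

pos-*⁴ : ∀ a b c e → + (a ℕ.* b ℕ.* c ℕ.* e) ≡ + a * + b * + c * + e
pos-*⁴ a b c e = trans (pos-* (a ℕ.* b ℕ.* c) e) (cong (_* + e) (pos-*³ a b c))

pos-mₛ : ∀ α P s → + mₛ α P s ≡ + 4 * + α * (+ s * + s) + + P
pos-mₛ α P s = trans (pos-+ (4 ℕ.* α ℕ.* (s ℕ.* s)) P)
  (cong (_+ + P) (trans (pos-* (4 ℕ.* α) (s ℕ.* s)) (cong₂ _*_ (pos-* 4 α) (pos-* s s))))

pos-Aₛ : ∀ α s m r → Aₛ α s m r ≡ + α * + s * (+ m * + r - + s)
pos-Aₛ α s m r = cong₂ (λ αs mr → αs * (mr - + s)) (pos-* α s) (pos-* m r)

pos-pred : ∀ {d n} → d ℕ.+ 1 ≡ n → + d ≡ + n - + 1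
pos-pred {d} refl = trans (shift (+ d)) (cong (_- + 1) (pos-+ d 1))
  where
  shift : ∀ x → x ≡ x + + 1 - + 1
  shift = solve-∀

cofactor-equationℤ : ∀ α P s d r m → d ℕ.+ 1 ≡ 4 ℕ.* α ℕ.* s ℕ.* r → d ℕ.* m ≡ mₛ α P s →
  (+ 4 * + α * + s * + r - + 1) * + m ≡ + 4 * + α * (+ s * + s) + + P
cofactor-equationℤ α P s d r m d+1≡4αsr dm≡mₛ = begin
  (+ 4 * + α * + s * + r - + 1) * + m ≡⟨ cong (_* + m) (sym (trans (pos-pred d+1≡4αsr) (cong (_- + 1) (pos-*⁴ 4 α s r)))) ⟩
  + d * + m                           ≡⟨ sym (pos-* d m) ⟩
  + (d ℕ.* m)                         ≡⟨ cong +_ dm≡mₛ ⟩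
  + mₛ α P s                          ≡⟨ pos-mₛ α P s ⟩
  + 4 * + α * (+ s * + s) + + P       ∎

mₛ-nonZero : ∀ α P s → .{{NonZero P}} → NonZero (mₛ α P s)
mₛ-nonZero α P s = >-nonZero (≤-trans (>-nonZero⁻¹ P) (m≤n+m P _))

cofactor-pos : ∀ d {m n} → d ℕ.* m ≡ n → NonZero n → 0 ℕ.< m
cofactor-pos d {m} dm≡n n≢0 = >-nonZero⁻¹ m {{m*n≢0⇒n≢0 d {{subst NonZero (sym dm≡n) n≢0}}}}

lemmaD24 : (α P s d : ℕ) → 0 ℕ.< α → Prime P → P % 2 ≡ 1 → 0 ℕ.< s →
    0 ℕ.< d → d ∣ mₛ α P s → (4 ℕ.* α ℕ.* s) ∣ (d ℕ.+ 1) →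
    (r m : ℕ) → d ℕ.+ 1 ≡ 4 ℕ.* α ℕ.* s ℕ.* r → d ℕ.* m ≡ mₛ α P s →
    InLU P (Aₛ α s m r) →
    ((((+ (4 ℕ.* α ℕ.* r ℕ.* s)) ℤ.- (+ 1)) ℤ.* ((+ 4) ℤ.* (+ α) ℤ.* (+ r) ℤ.* ((+ (m ℕ.* r)) ℤ.- (+ s)) ℤ.- (+ 1)))
        ≡ (+ (4 ℕ.* α ℕ.* P ℕ.* (r ℕ.* r))) ℤ.+ (+ 1))
    × InLU P (Aₛ α s m r)
    × (+ m ≡ (+ 4) ℤ.* Aₛ α s m r ℤ.- (+ P))
    × (0 ℕ.< m)
lemmaD24 α P s d _ P-prime _ _ _ _ _ r m d+1≡4αsr dm≡mₛ A∈[L,U] =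
  factorisation , A∈[L,U] , m≡4A-P , cofactor-pos d dm≡mₛ (mₛ-nonZero α P s {{prime⇒nonZero P-prime}})
  where
  cofactorℤ : (+ 4 * + α * + s * + r - + 1) * + m ≡ + 4 * + α * (+ s * + s) + + P
  cofactorℤ = cofactor-equationℤ α P s d r m d+1≡4αsr dm≡mₛ

  factorisation : (+ (4 ℕ.* α ℕ.* r ℕ.* s) - + 1) * (+ 4 * + α * + r * (+ (m ℕ.* r) - + s) - + 1)
                    ≡ + (4 ℕ.* α ℕ.* P ℕ.* (r ℕ.* r)) + + 1
  factorisation = begin
    (+ (4 ℕ.* α ℕ.* r ℕ.* s) - + 1) * (+ 4 * + α * + r * (+ (m ℕ.* r) - + s) - + 1)
      ≡⟨ cong₂ (λ αrs mr → (αrs - + 1) * (+ 4 * + α * + r * (mr - + s) - + 1)) (pos-*⁴ 4 α r s) (pos-* m r) ⟩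
    (+ 4 * + α * + r * + s - + 1) * (+ 4 * + α * + r * (+ m * + r - + s) - + 1)
      ≡⟨ 4αPr²+1-factorisation (+ α) (+ s) (+ r) (+ m) (+ P) cofactorℤ ⟩
    + 4 * + α * + P * (+ r * + r) + + 1
      ≡⟨ cong (_+ + 1) (sym (trans (pos-* (4 ℕ.* α ℕ.* P) (r ℕ.* r)) (cong₂ _*_ (pos-*³ 4 α P) (pos-* r r)))) ⟩
    + (4 ℕ.* α ℕ.* P ℕ.* (r ℕ.* r)) + + 1 ∎

  m≡4A-P : + m ≡ + 4 * Aₛ α s m r - + P
  m≡4A-P = trans (cofactor≡4A-P (+ α) (+ s) (+ r) (+ m) (+ P) cofactorℤ)
                 (cong (λ A → + 4 * A - + P) (sym (pos-Aₛ α s m r)))
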